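{- For $n\ge 2$, the number of strongly asymmetric nested canalizing functions on $n$ variables is $$N(n,n)=\frac{n!}{\sqrt2}\left((1+\sqrt2)^{n-1}-(1-\sqrt2)^{n-1}\right).$$
   Context: $\oplus$ is addition modulo 2. A Boolean function $f:\mathbb{F}_2^n\to\mathbb{F}_2$ is nested canalizing (NCF) if for some permutation $\sigma$ of $\{1,\dots,n\}$ and $a_i,b_i\in\mathbb{F}_2$: $f=b_1$ if $x_{\sigma(1)}=a_1$; $f=b_k$ if $x_{\sigma(i)}=a_i\oplus1$ for $i<k$ and $x_{\sigma(k)}=a_k$ ($k\le n$); and $f=b_n\oplus 1$ if $x_{\sigma(i)}=a_i\oplus 1$ for all $i$. A Boolean function $f$ is strongly asymmetric if $f(x_1,\dots,x_n)=f(x_{\sigma(1)},\dots,x_{\sigma(n)})$ (as functions) implies that the permutation $\sigma$ is the identity. $N(n,s)$ denotes the number of $n$-variable $s$-symmetric NCFs, where $f$ is $s$-symmetric if the equivalence relation $i\sim_f j$ (meaning $f$ is unchanged when $x_i,x_j$ are swapped) has exactly $s$ classes on $\{1,\dots,n\}$; for NCFs, being strongly asymmetric is equivalent to being $n$-symmetric. Functions are counted as distinct functions $\mathbb{F}_2^n\to\mathbb{F}_2$. -}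

module Defs where

open import Data.Bool using (Bool; not)
open import Data.Nat using (ℕ; zero; suc; _∸_; _<_)
open import Data.Integer using (ℤ; +_) renaming (_+_ to _+ℤ_; _*_ to _*ℤ_; -_ to -ℤ_)
open import Data.Fin using (Fin; toℕ)
open import Data.Fin.Permutation using (Permutation′; _⟨$⟩ʳ_)
open import Data.List using (List; length)
open import Data.List.Membership.Propositional using (_∈_)
open import Data.List.Relation.Unary.All using (All)
open import Data.List.Relation.Unary.AllPairs using (AllPairs)
open import Data.Product using (Σ; _×_; ∃; ∃-syntax; _,_)
open import Data.Product using () renaming (proj₁ to fst; proj₂ to snd)
open import Relation.Binary.PropositionalEquality using (_≡_)
open import Relation.Nullary using (¬_)

-- Inputs x ∈ F₂ⁿ (x i = x_{i+1}); Boolean functions F₂ⁿ → F₂.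
Input : ℕ → Set
Input n = Fin n → Bool

BoolFun : ℕ → Set
BoolFun n = Input n → Bool

_≐_ : ∀ {n} → BoolFun n → BoolFun n → Set
f ≐ g = ∀ x → f x ≡ g x

permuteVars : ∀ {n} → Permutation′ n → BoolFun n → BoolFun n
permuteVars σ f x = f (λ i → x (σ ⟨$⟩ʳ i))

IsNCF : ∀ {n} → BoolFun n → Set
IsNCF {n} f =
  Σ (Permutation′ n) λ σ → Σ (Fin n → Bool) λ a → Σ (Fin n → Bool) λ b →
    (∀ x (k : Fin n) →
       (∀ (i : Fin n) → toℕ i < toℕ k → x (σ ⟨$⟩ʳ i) ≡ not (a i)) →
       x (σ ⟨$⟩ʳ k) ≡ a k → f x ≡ b k)
    × (∀ x (last : Fin n) → suc (toℕ last) ≡ n →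
       (∀ (i : Fin n) → x (σ ⟨$⟩ʳ i) ≡ not (a i)) → f x ≡ not (b last))

StronglyAsymmetric : ∀ {n} → BoolFun n → Set
StronglyAsymmetric {n} f =
  (σ : Permutation′ n) → permuteVars σ f ≐ f → ∀ i → σ ⟨$⟩ʳ i ≡ i

Enumerates : ∀ {n} → (BoolFun n → Set) → List (BoolFun n) → Set
Enumerates {n} P L =
  All P L
  × AllPairs (λ f g → ¬ (f ≐ g)) L
  × (∀ (f : BoolFun n) → P f → ∃[ g ] (g ∈ L × (f ≐ g)))

-- The ring ℤ[√2]: (p , q) represents p + q√2.
ℤ√2 : Set
ℤ√2 = ℤ × ℤ

_⊕√_ : ℤ√2 → ℤ√2 → ℤ√2
(p , q) ⊕√ (r , s) = (p +ℤ r , q +ℤ s)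

_⊖√_ : ℤ√2 → ℤ√2 → ℤ√2
(p , q) ⊖√ (r , s) = (p +ℤ (-ℤ r) , q +ℤ (-ℤ s))

_⊛√_ : ℤ√2 → ℤ√2 → ℤ√2
(p , q) ⊛√ (r , s) = ((p *ℤ r) +ℤ ((+ 2) *ℤ (q *ℤ s)) , (p *ℤ s) +ℤ (q *ℤ r))

_^√_ : ℤ√2 → ℕ → ℤ√2
z ^√ zero = (+ 1 , + 0)
z ^√ suc k = z ⊛√ (z ^√ k)

fromℕ√ : ℕ → ℤ√2
fromℕ√ m = (+ m , + 0)

√2 : ℤ√2
√2 = (+ 0 , + 1)

1+√2 : ℤ√2
1+√2 = (+ 1 , + 1)

1-√2 : ℤ√2
1-√2 = (+ 1 , -ℤ (+ 1))

-- A strongly asymmetric NCF has a canonical normal form.  Read its canalizing rules as a decision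
-- list and group consecutive rules with the same output into layers; rules inside a layer commute.
-- Strong asymmetry forbids two rules of a layer with the same canalizing input (swapping their
-- variables would fix the function), so a layer is a single variable or a pair {x_v = 0, x_w = 1};
-- and since the output of the last rule can be flipped, the last layer may be taken to be a pair.
-- Conversely distinct chains of such layers give distinct strongly asymmetric NCFs, because the
-- first layer is recovered as the set of canalizing (variable, input) pairs.  Choosing the first
-- layer on k + 1 variables gives c(k+1) = (k+1)(2 c(k) + k c'(k-1)), where c' counts what may follow
-- a pair (the empty tail when no variable is left); this is solved by c(k) = k! P(k-1) with P the
-- Pell numbers, there are 2 c(n) functions, and 2√2 P(j) = (1+√2)^j - (1-√2)^j.
module Submission where

open import Defs
open import Data.Nat using (ℕ; _≤_; _∸_; _!)
open import Data.List using (List; length)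
open import Data.Product using (Σ; _×_)
open import Relation.Binary.PropositionalEquality using (_≡_)

open import Data.Bool using (Bool; true; false; not)
open import Data.Bool.Properties using (not-involutive; not-¬; ¬-not) renaming (_≟_ to _≟ᵇ_)
open import Data.Empty using (⊥; ⊥-elim)
open import Data.Fin using (Fin; zero; suc; toℕ; fromℕ) renaming (_≟_ to _≟ᶠ_)
open import Data.Fin.Properties using (toℕ-fromℕ)
open import Data.Fin.Permutation using (Permutation; _⟨$⟩ʳ_; _⟨$⟩ˡ_; permutation; transpose; inverseʳ; ↔⇒≡)
import Data.Fin.Permutation.Components as PC
open import Data.Integer using (ℤ; +_) renaming (_+_ to _+ℤ_; _*_ to _*ℤ_; -_ to -ℤ_)
import Data.Integer.Properties as ℤ
import Data.Integer.Tactic.RingSolver as ℤ-Solver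
open import Data.List using ([]; _∷_; map; _++_; concatMap; lookup; tabulate; filter; allFin)
open import Data.List.Properties using (length-++; length-map; length-tabulate; map-tabulate; filter-all)
open import Data.List.Membership.Propositional using (_∈_; _∉_; find; lose)
open import Data.List.Membership.Propositional.Properties
  using (∈-concatMap⁺; ∈-concatMap⁻; ∈-map⁺; ∈-map⁻; ∈-++⁺ˡ; ∈-++⁺ʳ; ∈-++⁻; ∈-filter⁺; ∈-filter⁻; ∈-tabulate⁺; ∈-allFin)
open import Data.List.Relation.Binary.Disjoint.Propositional using (Disjoint)
open import Data.List.Relation.Binary.Permutation.Propositional using (↭-swap; ↭-refl)
open import Data.List.Relation.Binary.Subset.Propositional using (_⊆_)
open import Data.List.Relation.Binary.Subset.Propositional.Properties using (∷⁺ʳ; ⊆-reflexive-↭; ⊆[]⇒≡[])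
open import Data.List.Relation.Unary.All as All using (All; []; _∷_)
open import Data.List.Relation.Unary.All.Properties as All using (All¬⇒¬Any; ¬Any⇒All¬)
open import Data.List.Relation.Unary.AllPairs as AllPairs using (AllPairs; []; _∷_)
import Data.List.Relation.Unary.AllPairs.Properties as AllPairs
open import Data.List.Relation.Unary.Any using (here; there)
open import Data.List.Relation.Unary.Unique.Propositional using (Unique)
import Data.List.Relation.Unary.Unique.Propositional.Properties as Unique
open import Data.Nat using (zero; suc; pred; _+_; _*_; _<_; s≤s; z≤n)
open import Data.Nat.Properties using (≤-pred; ≤-trans; n≤1+n; ≤-reflexive; suc-injective)
import Data.Nat.Tactic.RingSolver as ℕ-Solver
open import Data.Product using (∃-syntax; Σ-syntax; _,_; proj₁; proj₂)
open import Data.Sum using (_⊎_; inj₁; inj₂)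
open import Data.Unit using (⊤; tt)
open import Data.Vec.Functional using (updateAt)
open import Data.Vec.Functional.Properties using (updateAt-updates; updateAt-minimal)
open import Function using (_∘_; id)
open import Function.Bundles using (Injection)
open import Function.Properties.Inverse using (↔⇒↣)
open import Relation.Binary.PropositionalEquality
  using (_≢_; refl; sym; trans; cong; cong₂; subst; module ≡-Reasoning)
open import Relation.Nullary using (¬_; ¬?; Dec; yes; no; contradiction)
open import Relation.Nullary.Decidable using (_×-dec_; _⊎-dec_)

Unique⇒AllPairs : ∀ {A : Set} {R : A → A → Set} {xs : List A} →
  (∀ {x y} → x ∈ xs → y ∈ xs → x ≢ y → R x y) → Unique xs → AllPairs R xs
Unique⇒AllPairs R-distinct []         = []
Unique⇒AllPairs R-distinct (x∉ ∷ uxs) =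
  All.tabulate (λ y∈ → R-distinct (here refl) (there y∈) (All.lookup x∉ y∈))
  ∷ Unique⇒AllPairs (λ x∈ y∈ → R-distinct (there x∈) (there y∈)) uxs

module _ {A B : Set} where

  length-concatMap-const : (g : A → List B) (xs : List A) {k : ℕ} →
    (∀ {x} → x ∈ xs → length (g x) ≡ k) → length (concatMap g xs) ≡ length xs * k
  length-concatMap-const g []       h = refl
  length-concatMap-const g (x ∷ xs) h =
    trans (length-++ (g x)) (cong₂ _+_ (h (here refl)) (length-concatMap-const g xs (h ∘ there)))

  ∈-concatMap⁻′ : (g : A → List B) {xs : List A} {y : B} →
    y ∈ concatMap g xs → ∃[ x ] (x ∈ xs × y ∈ g x)
  ∈-concatMap⁻′ g = find ∘ ∈-concatMap⁻ g

  concatMap-unique : (g : A → List B) (key : B → A) → (∀ {x y} → y ∈ g x → key y ≡ x) →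
    {xs : List A} → Unique xs → (∀ {x} → x ∈ xs → Unique (g x)) → Unique (concatMap g xs)
  concatMap-unique g key keyed uxs ug =
    Unique.concat⁺ (All.map⁺ (All.tabulate ug)) (AllPairs.map⁺ (AllPairs.map disjoint uxs))
    where
    disjoint : ∀ {x x′} → x ≢ x′ → Disjoint (g x) (g x′)
    disjoint x≢x′ (y∈gx , y∈gx′) = x≢x′ (trans (sym (keyed y∈gx)) (keyed y∈gx′))

-- Pell numbers

-- (1 + √2)ʲ = halfCompanionPell j + pell j · √2
mutual
  halfCompanionPell : ℕ → ℕ
  halfCompanionPell zero    = 1
  halfCompanionPell (suc j) = halfCompanionPell j + 2 * pell j

  pell : ℕ → ℕ
  pell zero    = 0
  pell (suc j) = halfCompanionPell j + pell j

pell-suc-suc : ∀ j → pell (suc (suc j)) ≡ 2 * pell (suc j) + pell j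
pell-suc-suc j = identity (halfCompanionPell j) (pell j)
  where
  identity : ∀ h p → (h + 2 * p) + (h + p) ≡ 2 * (h + p) + p
  identity = ℕ-Solver.solve-∀

module _ (ε : ℤ) (ε²≡1 : ε *ℤ ε ≡ + 1) where

  ^√-unit : ∀ j → (+ 1 , ε) ^√ j ≡ (+ halfCompanionPell j , ε *ℤ + pell j)
  ^√-unit zero    = cong (+ 1 ,_) (sym (ℤ.*-zeroʳ ε))
  ^√-unit (suc j) = begin
      (+ 1 , ε) ⊛√ ((+ 1 , ε) ^√ j)
    ≡⟨ cong ((+ 1 , ε) ⊛√_) (^√-unit j) ⟩
      (+ 1 , ε) ⊛√ (+ h , ε *ℤ + p)
    ≡⟨ cong₂ _,_ real imaginary ⟩
      (+ (h + 2 * p) , ε *ℤ + (h + p))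
    ∎
    where
    open ≡-Reasoning
    h = halfCompanionPell j
    p = pell j
    real : + 1 *ℤ + h +ℤ + 2 *ℤ (ε *ℤ (ε *ℤ + p)) ≡ + (h + 2 * p)
    real = begin
        + 1 *ℤ + h +ℤ + 2 *ℤ (ε *ℤ (ε *ℤ + p))
      ≡⟨ regroup (+ h) (+ p) ε ⟩
        + h +ℤ + 2 *ℤ ((ε *ℤ ε) *ℤ + p)
      ≡⟨ cong (λ s → + h +ℤ + 2 *ℤ (s *ℤ + p)) ε²≡1 ⟩
        + h +ℤ + 2 *ℤ (+ 1 *ℤ + p)
      ≡⟨ cong (λ s → + h +ℤ + 2 *ℤ s) (ℤ.*-identityˡ (+ p)) ⟩
        + h +ℤ + 2 *ℤ + p
      ≡⟨ sym (trans (ℤ.pos-+ h (2 * p)) (cong (+ h +ℤ_) (ℤ.pos-* 2 p))) ⟩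
        + (h + 2 * p)
      ∎
      where
      regroup : ∀ x y e → + 1 *ℤ x +ℤ + 2 *ℤ (e *ℤ (e *ℤ y)) ≡ x +ℤ + 2 *ℤ ((e *ℤ e) *ℤ y)
      regroup = ℤ-Solver.solve-∀
    imaginary : + 1 *ℤ (ε *ℤ + p) +ℤ ε *ℤ + h ≡ ε *ℤ + (h + p)
    imaginary = trans (distrib (+ h) (+ p) ε) (cong (ε *ℤ_) (sym (ℤ.pos-+ h p)))
      where
      distrib : ∀ x y e → + 1 *ℤ (e *ℤ y) +ℤ e *ℤ x ≡ e *ℤ (x +ℤ y)
      distrib = ℤ-Solver.solve-∀

√2-⊛-twicePell : ∀ m j → √2 ⊛√ fromℕ√ (m * pell j + m * pell j)
                         ≡ fromℕ√ m ⊛√ ((1+√2 ^√ j) ⊖√ (1-√2 ^√ j))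
√2-⊛-twicePell m j = begin
    √2 ⊛√ (+ (m * p + m * p) , + 0)
  ≡⟨ cong (λ z → √2 ⊛√ (z , + 0)) (trans (ℤ.pos-+ (m * p) (m * p)) (cong₂ _+ℤ_ mp mp)) ⟩
    √2 ⊛√ (+ m *ℤ + p +ℤ + m *ℤ + p , + 0)
  ≡⟨ cong₂ _,_ (real (+ m) (+ h) (+ p)) (imaginary (+ m) (+ h) (+ p)) ⟩
    fromℕ√ m ⊛√ ((+ h , + 1 *ℤ + p) ⊖√ (+ h , -ℤ + 1 *ℤ + p))
  ≡⟨ sym (cong₂ (λ u v → fromℕ√ m ⊛√ (u ⊖√ v)) (^√-unit (+ 1) refl j) (^√-unit (-ℤ + 1) refl j)) ⟩
    fromℕ√ m ⊛√ ((1+√2 ^√ j) ⊖√ (1-√2 ^√ j))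
  ∎
  where
  open ≡-Reasoning
  h = halfCompanionPell j
  p = pell j
  mp : + (m * p) ≡ + m *ℤ + p
  mp = ℤ.pos-* m p
  real : ∀ x y z → + 0 *ℤ (x *ℤ z +ℤ x *ℤ z) +ℤ + 2 *ℤ (+ 1 *ℤ + 0)
                 ≡ x *ℤ (y +ℤ -ℤ y) +ℤ + 2 *ℤ (+ 0 *ℤ (+ 1 *ℤ z +ℤ -ℤ (-ℤ + 1 *ℤ z)))
  real = ℤ-Solver.solve-∀
  imaginary : ∀ x y z → + 0 *ℤ + 0 +ℤ + 1 *ℤ (x *ℤ z +ℤ x *ℤ z)
                      ≡ x *ℤ (+ 1 *ℤ z +ℤ -ℤ (-ℤ + 1 *ℤ z)) +ℤ + 0 *ℤ (y +ℤ -ℤ y)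
  imaginary = ℤ-Solver.solve-∀

-- chainCount k counts the normal forms on k variables and tailCount k what may follow a pair
-- layer when k variables are left (see chains-length).
chainCount : ℕ → ℕ
chainCount k = k ! * pell (pred k)

tailCount : ℕ → ℕ
tailCount zero    = 1
tailCount (suc k) = chainCount (suc k)

chainCount-suc : ∀ k →
  chainCount (suc k) ≡ suc k * (chainCount k + (chainCount k + k * tailCount (pred k)))
chainCount-suc zero          = refl
chainCount-suc (suc zero)    = refl
chainCount-suc (suc (suc j)) rewrite pell-suc-suc j = identity j (suc j !) (pell (suc j)) (pell j)
  where
  identity : ∀ j f p₁ p₀ →
    suc (suc (suc j)) * (suc (suc j) * f) * (2 * p₁ + p₀)
    ≡ suc (suc (suc j)) * (suc (suc j) * f * p₁ + (suc (suc j) * f * p₁ + suc (suc j) * (f * p₀)))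
  identity = ℕ-Solver.solve-∀

-- Decision lists

canalize : Bool → Bool → Bool → Bool → Bool
canalize true  true  b r = b
canalize false false b r = b
canalize true  false b r = r
canalize false true  b r = r

canalize-hit : ∀ {c a} b r → c ≡ a → canalize c a b r ≡ b
canalize-hit {true}  b r refl = refl
canalize-hit {false} b r refl = refl

canalize-miss : ∀ {c a} b r → c ≡ not a → canalize c a b r ≡ r
canalize-miss {true}  {false} b r refl = refl
canalize-miss {false} {true}  b r refl = refl

canalize-idem : ∀ c a b → canalize c a b b ≡ b
canalize-idem true  true  b = refl
canalize-idem false false b = refl
canalize-idem true  false b = refl
canalize-idem false true  b = refl

canalize-comm : ∀ p a q a′ c r →
  canalize p a c (canalize q a′ c r) ≡ canalize q a′ c (canalize p a c r)
canalize-comm true  true  q a′ c r = sym (canalize-idem q a′ c)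
canalize-comm false false q a′ c r = sym (canalize-idem q a′ c)
canalize-comm true  false q a′ c r = refl
canalize-comm false true  q a′ c r = refl

canalize-negate : ∀ q a b → canalize q a b (not b) ≡ canalize q (not a) (not b) b
canalize-negate true  true  b = refl
canalize-negate true  false b = refl
canalize-negate false true  b = refl
canalize-negate false false b = refl

-- The last rule of a decision list can be given either output.
canalize-retarget : ∀ c b a → Σ[ a′ ∈ Bool ] (∀ q → canalize q a b (not b) ≡ canalize q a′ c (not c))
canalize-retarget true  true  a = a , λ q → refl
canalize-retarget false false a = a , λ q → refl
canalize-retarget true  false a = not a , λ q → canalize-negate q a false
canalize-retarget false true  a = not a , λ q → canalize-negate q a true

module NestedCanalizing (n : ℕ) where

  Var : Set
  Var = Fin n

  set : Input n → Var → Bool → Input n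
  set x v c = updateAt x v (λ _ → c)

  set-same : ∀ x v c → set x v c v ≡ c
  set-same x v c = updateAt-updates v x

  set-other : ∀ x {i v} c → i ≢ v → set x v c i ≡ x i
  set-other x {i} {v} c = updateAt-minimal i v x

  transpose-left : ∀ (u w : Var) → PC.transpose u w u ≡ w
  transpose-left u w with u ≟ᶠ u
  ... | yes _  = refl
  ... | no u≢u = contradiction refl u≢u

  transpose-right : ∀ (u w : Var) → PC.transpose u w w ≡ u
  transpose-right u w with w ≟ᶠ u
  ... | yes w≡u = w≡u
  ... | no _ with w ≟ᶠ w
  ...   | yes _  = refl
  ...   | no w≢w = contradiction refl w≢w

  transpose-other : ∀ {u w i : Var} → i ≢ u → i ≢ w → PC.transpose u w i ≡ i
  transpose-other {u} {w} {i} i≢u i≢w with i ≟ᶠ u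
  ... | yes i≡u = contradiction i≡u i≢u
  ... | no _ with i ≟ᶠ w
  ...   | yes i≡w = contradiction i≡w i≢w
  ...   | no _    = refl

  record Rule : Set where
    constructor rule
    field
      var    : Var
      input  : Bool
      output : Bool
  open Rule public

  decide : List Rule → Bool → BoolFun n
  decide []               d x = d
  decide (rule v a b ∷ R) d x = canalize (x v) a b (decide R d x)

  varsOf : List Rule → List Var
  varsOf = map var

  lastRule : Rule → List Rule → Rule
  lastRule r []      = r
  lastRule r (s ∷ R) = lastRule s R

  decide-local : ∀ R d {x y : Input n} → (∀ {i} → i ∈ varsOf R → x i ≡ y i) →
    decide R d x ≡ decide R d y
  decide-local []               d eq = refl
  decide-local (rule v a b ∷ R) d eq =
    cong₂ (λ p q → canalize p a b q) (eq (here refl)) (decide-local R d (eq ∘ there))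

  decide-hit : ∀ R d x (k : Fin (length R)) →
    (∀ i → toℕ i < toℕ k → x (var (lookup R i)) ≡ not (input (lookup R i))) →
    x (var (lookup R k)) ≡ input (lookup R k) → decide R d x ≡ output (lookup R k)
  decide-hit (rule v a b ∷ R) d x zero    misses hit = canalize-hit b _ hit
  decide-hit (rule v a b ∷ R) d x (suc k) misses hit =
    trans (canalize-miss b _ (misses zero (s≤s z≤n)))
          (decide-hit R d x k (λ i i<k → misses (suc i) (s≤s i<k)) hit)

  decide-miss : ∀ R d x → (∀ i → x (var (lookup R i)) ≡ not (input (lookup R i))) →
    decide R d x ≡ d
  decide-miss []               d x misses = refl
  decide-miss (rule v a b ∷ R) d x misses =
    trans (canalize-miss b _ (misses zero)) (decide-miss R d x (misses ∘ suc))

  position : ∀ R {i} → i ∈ varsOf R → Fin (length R)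
  position (r ∷ R) (here _)  = zero
  position (r ∷ R) (there p) = suc (position R p)

  var-position : ∀ R {i} (p : i ∈ varsOf R) → var (lookup R (position R p)) ≡ i
  var-position (r ∷ R) (here i≡r) = sym i≡r
  var-position (r ∷ R) (there p)  = var-position R p

  var-lookup∈ : ∀ R k → var (lookup R k) ∈ varsOf R
  var-lookup∈ (r ∷ R) zero    = here refl
  var-lookup∈ (r ∷ R) (suc k) = there (var-lookup∈ R k)

  position-var : ∀ R → Unique (varsOf R) → ∀ k (p : var (lookup R k) ∈ varsOf R) → position R p ≡ k
  position-var (r ∷ R) uR         zero    (here _)  = refl
  position-var (r ∷ R) (r∉R ∷ uR) zero    (there p) = contradiction p (All¬⇒¬Any r∉R)
  position-var (r ∷ R) (r∉R ∷ uR) (suc k) (here e)  =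
    contradiction (subst (_∈ varsOf R) e (var-lookup∈ R k)) (All¬⇒¬Any r∉R)
  position-var (r ∷ R) (r∉R ∷ uR) (suc k) (there p) = cong suc (position-var R uR k p)

  -- IsNCF with the canalizing order indexed by Fin m, for decision lists of length m ≡ n
  IsNCFOver : ℕ → BoolFun n → Set
  IsNCFOver m f =
    Σ (Permutation m n) λ σ → Σ (Fin m → Bool) λ a → Σ (Fin m → Bool) λ b →
      (∀ x (k : Fin m) →
         (∀ (i : Fin m) → toℕ i < toℕ k → x (σ ⟨$⟩ʳ i) ≡ not (a i)) →
         x (σ ⟨$⟩ʳ k) ≡ a k → f x ≡ b k)
      × (∀ x (last : Fin m) → suc (toℕ last) ≡ m →
         (∀ (i : Fin m) → x (σ ⟨$⟩ʳ i) ≡ not (a i)) → f x ≡ not (b last))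

  decide-IsNCF : ∀ R d → Unique (varsOf R) → (∀ i → i ∈ varsOf R) →
    (∀ l → suc (toℕ l) ≡ length R → output (lookup R l) ≡ not d) → IsNCF (decide R d)
  decide-IsNCF R d uR cover lastOutput =
    subst (λ m → IsNCFOver m (decide R d)) (↔⇒≡ σ)
      (σ , input ∘ lookup R , output ∘ lookup R , decide-hit R d , allMiss)
    where
    σ : Permutation (length R) n
    σ = permutation (var ∘ lookup R) (λ i → position R (cover i))
          (λ i → var-position R (cover i)) (λ k → position-var R uR k (cover _))
    allMiss : ∀ x l → suc (toℕ l) ≡ length R →
      (∀ i → x (var (lookup R i)) ≡ not (input (lookup R i))) → decide R d x ≡ not (output (lookup R l))
    allMiss x l isLast misses =
      trans (decide-miss R d x misses) (trans (sym (not-involutive d)) (cong not (sym (lastOutput l isLast))))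

  IsNCF⇒decide : ∀ {m} (r : Fin m → Rule) d (f : BoolFun n) x →
    (∀ k → (∀ i → toℕ i < toℕ k → x (var (r i)) ≡ not (input (r i))) →
       x (var (r k)) ≡ input (r k) → f x ≡ output (r k)) →
    ((∀ i → x (var (r i)) ≡ not (input (r i))) → f x ≡ d) → f x ≡ decide (tabulate r) d x
  IsNCF⇒decide {zero}  r d f x hit allMiss = allMiss (λ ())
  IsNCF⇒decide {suc m} r d f x hit allMiss with x (var (r zero)) ≟ᵇ input (r zero)
  ... | yes hit₀ = trans (hit zero (λ i ()) hit₀) (sym (canalize-hit (output (r zero)) _ hit₀))
  ... | no miss₀ =
    trans (IsNCF⇒decide (r ∘ suc) d f x hitLater allMissLater)
          (sym (canalize-miss (output (r zero)) _ (¬-not miss₀)))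
    where
    hitLater : ∀ k → (∀ i → toℕ i < toℕ k → x (var (r (suc i))) ≡ not (input (r (suc i)))) →
      x (var (r (suc k))) ≡ input (r (suc k)) → f x ≡ output (r (suc k))
    hitLater k misses = hit (suc k) misses′
      where
      misses′ : ∀ i → toℕ i < toℕ (suc k) → x (var (r i)) ≡ not (input (r i))
      misses′ zero    _         = ¬-not miss₀
      misses′ (suc i) (s≤s i<k) = misses i i<k
    allMissLater : (∀ i → x (var (r (suc i))) ≡ not (input (r (suc i)))) → f x ≡ d
    allMissLater misses = allMiss λ { zero → ¬-not miss₀ ; (suc i) → misses i }

  lastRule-tabulate : ∀ k (r : Fin (suc k) → Rule) → lastRule (r zero) (tabulate (r ∘ suc)) ≡ r (fromℕ k)
  lastRule-tabulate zero    r = refl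
  lastRule-tabulate (suc k) r = lastRule-tabulate k (r ∘ suc)

  SwapInvariant : Var → Var → BoolFun n → Set
  SwapInvariant u w g = ∀ x → g (x ∘ PC.transpose u w) ≡ g x

  Rigid : List Var → BoolFun n → Set
  Rigid vs g = ∀ {u w} → u ≢ w → u ∈ vs → w ∈ vs → ¬ SwapInvariant u w g

  rigid-≐ : ∀ {vs} {g h : BoolFun n} → g ≐ h → Rigid vs g → Rigid vs h
  rigid-≐ g≐h rig u≢w u∈ w∈ inv = rig u≢w u∈ w∈ λ x → trans (g≐h _) (trans (inv x) (sym (g≐h x)))

  rigid-⊆ : ∀ {vs ws} {g : BoolFun n} → ws ⊆ vs → Rigid vs g → Rigid ws g
  rigid-⊆ ws⊆vs rig u≢w u∈ w∈ = rig u≢w (ws⊆vs u∈) (ws⊆vs w∈)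

  decide-transpose-outside : ∀ R d {u w} → u ∉ varsOf R → w ∉ varsOf R → SwapInvariant u w (decide R d)
  decide-transpose-outside R d u∉R w∉R x =
    decide-local R d λ i∈R → cong x (transpose-other (λ { refl → u∉R i∈R }) (λ { refl → w∉R i∈R }))

  decide-swap-cons : ∀ r R d {u w} → var r ≢ u → var r ≢ w →
    SwapInvariant u w (decide R d) → SwapInvariant u w (decide (r ∷ R) d)
  decide-swap-cons (rule v a b) R d v≢u v≢w inv x =
    cong₂ (λ p q → canalize p a b q) (cong x (transpose-other v≢u v≢w)) (inv x)

  decide-swap-twins : ∀ {u w} a c R d → u ∉ varsOf R → w ∉ varsOf R →
    SwapInvariant u w (decide (rule u a c ∷ rule w a c ∷ R) d)
  decide-swap-twins {u} {w} a c R d u∉R w∉R x =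
    trans (cong₂ (λ p q → canalize p a c q) (cong x (transpose-left u w))
            (cong₂ (λ p q → canalize p a c q) (cong x (transpose-right u w))
              (decide-transpose-outside R d u∉R w∉R x)))
          (canalize-comm (x w) a (x u) a c _)

  rigid-tail : ∀ r R d → var r ∉ varsOf R →
    Rigid (varsOf (r ∷ R)) (decide (r ∷ R) d) → Rigid (varsOf R) (decide R d)
  rigid-tail r R d r∉R rig u≢w u∈ w∈ inv =
    rig u≢w (there u∈) (there w∈)
      (decide-swap-cons r R d (λ { refl → r∉R u∈ }) (λ { refl → r∉R w∈ }) inv)

  -- Of three rules with a common output, two have the same input and can be swapped.
  layer-of-three : ∀ u w v a a′ c R d →
    Unique (varsOf (rule u a c ∷ rule w (not a) c ∷ rule v a′ c ∷ R)) →
    ¬ Rigid (varsOf (rule u a c ∷ rule w (not a) c ∷ rule v a′ c ∷ R))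
            (decide (rule u a c ∷ rule w (not a) c ∷ rule v a′ c ∷ R) d)
  layer-of-three u w v a a′ c R d ((u≢w ∷ u≢v ∷ u∉R) ∷ (w≢v ∷ w∉R) ∷ v∉R ∷ _) rig with a′ ≟ᵇ a
  ... | yes refl =
    rigid-≐ (λ x → canalize-comm (x u) a (x w) (not a) c _) rig u≢v (here refl) (there (there (here refl)))
      (decide-swap-cons (rule w (not a) c) (rule u a c ∷ rule v a c ∷ R) d (u≢w ∘ sym) w≢v
        (decide-swap-twins a c R d (All¬⇒¬Any u∉R) (All¬⇒¬Any v∉R)))
  ... | no a′≢a rewrite ¬-not a′≢a =
    rig w≢v (there (here refl)) (there (there (here refl)))
      (decide-swap-cons (rule u a c) (rule w (not a) c ∷ rule v (not a) c ∷ R) d u≢w u≢v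
        (decide-swap-twins (not a) c R d (All¬⇒¬Any w∉R) (All¬⇒¬Any v∉R)))

  -- Layers and chains

  data Layer : Set where
    one : Var → Bool → Layer
    two : Var → Var → Layer

  LayerHas : Layer → Var → Bool → Set
  LayerHas (one v a₀) u a = u ≡ v × a ≡ a₀
  LayerHas (two v w)  u a = (u ≡ v × a ≡ false) ⊎ (u ≡ w × a ≡ true)

  layerHas? : ∀ ℓ u a → Dec (LayerHas ℓ u a)
  layerHas? (one v a₀) u a = (u ≟ᶠ v) ×-dec (a ≟ᵇ a₀)
  layerHas? (two v w)  u a = ((u ≟ᶠ v) ×-dec (a ≟ᵇ false)) ⊎-dec ((u ≟ᶠ w) ×-dec (a ≟ᵇ true))

  ValidLayer : Layer → Set
  ValidLayer (one v a) = ⊤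
  ValidLayer (two v w) = v ≢ w

  layer-ext : ∀ {ℓ ℓ′} → ValidLayer ℓ → ValidLayer ℓ′ →
    (∀ {u a} → LayerHas ℓ u a → LayerHas ℓ′ u a) → (∀ {u a} → LayerHas ℓ′ u a → LayerHas ℓ u a) → ℓ ≡ ℓ′
  layer-ext {one v a} {one v′ a′} _ _ to _ with to (refl , refl)
  ... | refl , refl = refl
  layer-ext {one v a} {two v′ w′} _ v′≢w′ _ from with from (inj₁ (refl , refl)) | from (inj₂ (refl , refl))
  ... | refl , _ | refl , _ = contradiction refl v′≢w′
  layer-ext {two v w} {one v′ a′} v≢w _ to from = sym (layer-ext {one v′ a′} {two v w} tt v≢w from to)
  layer-ext {two v w} {two v′ w′} _ _ to _ with to (inj₁ (refl , refl)) | to (inj₂ (refl , refl))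
  ... | inj₁ (refl , _) | inj₂ (refl , _) = refl
  ... | inj₂ (_ , ())   | _
  ... | _               | inj₁ (_ , ())

  outside-layer : ∀ ℓ → ValidLayer ℓ → Σ[ u ∈ Var ] Σ[ a ∈ Bool ] ¬ LayerHas ℓ u a
  outside-layer (one v a) _   = v , not a , λ { (_ , a≡¬a) → not-¬ refl (sym a≡¬a) }
  outside-layer (two v w) v≢w = v , true , λ { (inj₁ (_ , ())) ; (inj₂ (v≡w , _)) → v≢w v≡w }

  -- A chain lists the layers of a normal form; the layer outputs alternate, starting from the
  -- output passed to ⟦_⟧, and a chain ends with a two-variable layer, after which the value is
  -- the opposite of that layer's output.
  data Chain : Set where
    end    : Var → Var → Chain
    single : Var → Bool → Chain → Chain
    pair   : Var → Var → Chain → Chain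

  firstLayer : Chain → Layer
  firstLayer (end v w)      = two v w
  firstLayer (single v a I) = one v a
  firstLayer (pair v w I)   = two v w

  rules : Chain → Bool → List Rule
  rules (end v w)      b = rule v false b ∷ rule w true b ∷ []
  rules (single v a I) b = rule v a b ∷ rules I (not b)
  rules (pair v w I)   b = rule v false b ∷ rule w true b ∷ rules I (not b)

  lastOutput : Chain → Bool → Bool
  lastOutput (end v w)      b = b
  lastOutput (single v a I) b = lastOutput I (not b)
  lastOutput (pair v w I)   b = lastOutput I (not b)

  ⟦_⟧ : Chain → Bool → BoolFun n
  ⟦ I ⟧ b = decide (rules I b) (not (lastOutput I b))

  vars : Chain → List Var
  vars (end v w)      = v ∷ w ∷ []
  vars (single v a I) = v ∷ vars I
  vars (pair v w I)   = v ∷ w ∷ vars I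

  varsOf-rules : ∀ I b → varsOf (rules I b) ≡ vars I
  varsOf-rules (end v w)      b = refl
  varsOf-rules (single v a I) b = cong (v ∷_) (varsOf-rules I (not b))
  varsOf-rules (pair v w I)   b = cong (λ vs → v ∷ w ∷ vs) (varsOf-rules I (not b))

  ⟦⟧-local : ∀ I b {x y : Input n} → (∀ {i} → i ∈ vars I → x i ≡ y i) → ⟦ I ⟧ b x ≡ ⟦ I ⟧ b y
  ⟦⟧-local I b eq = decide-local (rules I b) _ (eq ∘ subst (_ ∈_) (varsOf-rules I b))

  firstLayer-valid : ∀ I → Unique (vars I) → ValidLayer (firstLayer I)
  firstLayer-valid (end v w)      ((v≢w ∷ _) ∷ _) = v≢w
  firstLayer-valid (single v a I) _               = tt
  firstLayer-valid (pair v w I)   ((v≢w ∷ _) ∷ _) = v≢w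

  firstLayer⊆vars : ∀ I {u a} → LayerHas (firstLayer I) u a → u ∈ vars I
  firstLayer⊆vars (end v w)      (inj₁ (refl , _)) = here refl
  firstLayer⊆vars (end v w)      (inj₂ (refl , _)) = there (here refl)
  firstLayer⊆vars (single v a I) (refl , _)        = here refl
  firstLayer⊆vars (pair v w I)   (inj₁ (refl , _)) = here refl
  firstLayer⊆vars (pair v w I)   (inj₂ (refl , _)) = there (here refl)

  pair-hit : ∀ p q b r → p ≡ false ⊎ q ≡ true → canalize p false b (canalize q true b r) ≡ b
  pair-hit p     q b r (inj₁ p≡false) = canalize-hit b _ p≡false
  pair-hit false q b r (inj₂ q≡true)  = refl
  pair-hit true  q b r (inj₂ q≡true)  = canalize-hit b r q≡true

  pair-miss : ∀ {p q} b r → p ≡ true → q ≡ false → canalize p false b (canalize q true b r) ≡ r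
  pair-miss b r refl refl = refl

  missPair : Input n → Var → Var → Input n
  missPair x v w = set (set x v true) w false

  missPair-left : ∀ x {v w} → v ≢ w → missPair x v w v ≡ true
  missPair-left x {v} {w} v≢w = trans (set-other _ false v≢w) (set-same x v true)

  missPair-right : ∀ x v w → missPair x v w w ≡ false
  missPair-right x v w = set-same _ w false

  missPair-other : ∀ x {v w i} → i ≢ v → i ≢ w → missPair x v w i ≡ x i
  missPair-other x i≢v i≢w = trans (set-other _ false i≢w) (set-other x true i≢v)

  missPair-at : ∀ x {v w} u a → v ≢ w → ¬ LayerHas (two v w) u a → x u ≡ a → missPair x v w u ≡ a
  missPair-at x {v} {w} u a v≢w ¬has xu≡a with u ≟ᶠ w | u ≟ᶠ v
  ... | yes refl | _        = trans (missPair-right x v w) (sym (¬-not λ a≡true → ¬has (inj₂ (refl , a≡true))))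
  ... | no u≢w   | yes refl = trans (missPair-left x v≢w) (sym (¬-not λ a≡false → ¬has (inj₁ (refl , a≡false))))
  ... | no u≢w   | no u≢v   = trans (missPair-other x u≢v u≢w) xu≡a

  single-peel : ∀ v a I b x → v ∉ vars I → ⟦ single v a I ⟧ b (set x v (not a)) ≡ ⟦ I ⟧ (not b) x
  single-peel v a I b x v∉I =
    trans (canalize-miss b _ (set-same x v (not a)))
          (⟦⟧-local I (not b) λ i∈I → set-other x (not a) λ { refl → v∉I i∈I })

  pair-peel : ∀ v w I b x → v ≢ w → v ∉ vars I → w ∉ vars I →
    ⟦ pair v w I ⟧ b (missPair x v w) ≡ ⟦ I ⟧ (not b) x
  pair-peel v w I b x v≢w v∉I w∉I =
    trans (pair-miss b (⟦ I ⟧ (not b) (missPair x v w)) (missPair-left x v≢w) (missPair-right x v w))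
          (⟦⟧-local I (not b) λ i∈I → missPair-other x (λ { refl → v∉I i∈I }) (λ { refl → w∉I i∈I }))

  end-peel : ∀ v w b x → v ≢ w → ⟦ end v w ⟧ b (missPair x v w) ≡ not b
  end-peel v w b x v≢w = pair-miss b (not b) (missPair-left x v≢w) (missPair-right x v w)

  Canalizes : BoolFun n → Var → Bool → Bool → Set
  Canalizes g u a c = ∀ x → x u ≡ a → g x ≡ c

  pair-attains-first : ∀ v w (g : Input n → Bool) → v ≢ w → ∀ b u a →
    ∃[ x ] (x u ≡ a × canalize (x v) false b (canalize (x w) true b (g x)) ≡ b)
  pair-attains-first v w g v≢w b u a with u ≟ᶠ v
  ... | no u≢v = set (λ _ → a) v false , set-other _ false u≢v , canalize-hit b _ (set-same _ v false)
  pair-attains-first v w g v≢w b u false | yes refl = (λ _ → false) , refl , refl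
  pair-attains-first v w g v≢w b u true  | yes refl =
    x , set-other _ true v≢w , pair-hit (x v) (x w) b (g x) (inj₂ (set-same _ w true))
    where
    x = set (λ _ → true) w true

  mutual
    attains-first : ∀ I → Unique (vars I) → ∀ b u a → ∃[ x ] (x u ≡ a × ⟦ I ⟧ b x ≡ b)
    attains-first (end v w)      uI b u a = pair-attains-first v w _ (firstLayer-valid (end v w) uI) b u a
    attains-first (pair v w I)   uI b u a = pair-attains-first v w _ (firstLayer-valid (pair v w I) uI) b u a
    attains-first (single v a₀ I) (v∉I ∷ uI) b u a with u ≟ᶠ v
    ... | no u≢v = set (λ _ → a) v a₀ , set-other _ a₀ u≢v , canalize-hit b _ (set-same _ v a₀)
    ... | yes refl with a ≟ᵇ a₀
    ...   | yes refl = (λ _ → a) , refl , canalize-hit {a} b _ refl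
    ...   | no a≢a₀ =
      let (y , yu≡a , ⟦I⟧y) = attains-opposite I uI (not b) u a (All¬⇒¬Any v∉I ∘ firstLayer⊆vars I)
      in y , yu≡a , trans (canalize-miss b _ (trans yu≡a (¬-not a≢a₀))) (trans ⟦I⟧y (not-involutive b))

    attains-opposite : ∀ I → Unique (vars I) → ∀ b u a → ¬ LayerHas (firstLayer I) u a →
      ∃[ x ] (x u ≡ a × ⟦ I ⟧ b x ≡ not b)
    attains-opposite (end v w) ((v≢w ∷ _) ∷ _) b u a ¬has =
      missPair (λ _ → a) v w , missPair-at _ u a v≢w ¬has refl , end-peel v w b _ v≢w
    attains-opposite (single v a₀ I) (v∉I ∷ uI) b u a ¬has =
      let (y , yu≡a , ⟦I⟧y) = attains-first I uI (not b) u a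
      in set y v (not a₀) , at-u y yu≡a , trans (single-peel v a₀ I b y (All¬⇒¬Any v∉I)) ⟦I⟧y
      where
      at-u : ∀ y → y u ≡ a → set y v (not a₀) u ≡ a
      at-u y yu≡a with u ≟ᶠ v
      ... | yes refl = trans (set-same y v (not a₀)) (sym (¬-not λ a≡a₀ → ¬has (refl , a≡a₀)))
      ... | no u≢v   = trans (set-other y (not a₀) u≢v) yu≡a
    attains-opposite (pair v w I) ((v≢w ∷ v∉I) ∷ w∉I ∷ uI) b u a ¬has =
      let (y , yu≡a , ⟦I⟧y) = attains-first I uI (not b) u a
      in missPair y v w , missPair-at y u a v≢w ¬has yu≡a ,
         trans (pair-peel v w I b y v≢w (All¬⇒¬Any v∉I) (All¬⇒¬Any w∉I)) ⟦I⟧y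

  ⟦⟧-nonconstant : ∀ I → Unique (vars I) → ∀ c → ¬ (∀ x → ⟦ I ⟧ c x ≡ c)
  ⟦⟧-nonconstant I uI c const =
    let (u , a , ¬has) = outside-layer (firstLayer I) (firstLayer-valid I uI)
        (x , _ , ⟦I⟧x) = attains-opposite I uI c u a ¬has
    in not-¬ refl (trans (sym (const x)) ⟦I⟧x)

  canalizes-⟦⟧ : ∀ I b {u a} → LayerHas (firstLayer I) u a → Canalizes (⟦ I ⟧ b) u a b
  canalizes-⟦⟧ (end v w)      b (inj₁ (refl , refl)) x xu = pair-hit (x v) (x w) b _ (inj₁ xu)
  canalizes-⟦⟧ (end v w)      b (inj₂ (refl , refl)) x xu = pair-hit (x v) (x w) b _ (inj₂ xu)
  canalizes-⟦⟧ (single v a I) b (refl , refl)        x xu = canalize-hit b _ xu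
  canalizes-⟦⟧ (pair v w I)   b (inj₁ (refl , refl)) x xu = pair-hit (x v) (x w) b _ (inj₁ xu)
  canalizes-⟦⟧ (pair v w I)   b (inj₂ (refl , refl)) x xu = pair-hit (x v) (x w) b _ (inj₂ xu)

  ⟦⟧-canalizes : ∀ I → Unique (vars I) → ∀ {b u a c} → Canalizes (⟦ I ⟧ b) u a c →
    LayerHas (firstLayer I) u a × c ≡ b
  ⟦⟧-canalizes I uI {b} {u} {a} can with attains-first I uI b u a | layerHas? (firstLayer I) u a
  ... | x , xu≡a , ⟦I⟧x | yes has = has , trans (sym (can x xu≡a)) ⟦I⟧x
  ... | x , xu≡a , ⟦I⟧x | no ¬has =
    let (y , yu≡a , ⟦I⟧y) = attains-opposite I uI b u a ¬has
    in contradiction (trans (trans (sym ⟦I⟧x) (can x xu≡a)) (trans (sym (can y yu≡a)) ⟦I⟧y)) (not-¬ refl)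

  firstLayer-transfer : ∀ I J {b b′} → Unique (vars J) → ⟦ I ⟧ b ≐ ⟦ J ⟧ b′ →
    ∀ {u a} → LayerHas (firstLayer I) u a → LayerHas (firstLayer J) u a × b ≡ b′
  firstLayer-transfer I J {b} uJ I≐J has = ⟦⟧-canalizes J uJ λ x xu → trans (sym (I≐J x)) (canalizes-⟦⟧ I b has x xu)

  inside-layer : ∀ ℓ → Σ[ u ∈ Var ] Σ[ a ∈ Bool ] LayerHas ℓ u a
  inside-layer (one v a) = v , a , refl , refl
  inside-layer (two v w) = v , false , inj₁ (refl , refl)

  pair≢end : ∀ v w I b → Unique (vars (pair v w I)) → ¬ (⟦ pair v w I ⟧ b ≐ ⟦ end v w ⟧ b)
  pair≢end v w I b ((v≢w ∷ v∉I) ∷ w∉I ∷ uI) I≐J = ⟦⟧-nonconstant I uI (not b) λ x →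
    trans (sym (pair-peel v w I b x v≢w (All¬⇒¬Any v∉I) (All¬⇒¬Any w∉I)))
          (trans (I≐J (missPair x v w)) (end-peel v w b x v≢w))

  mutual
    ⟦⟧-injective : ∀ I J {b b′} → Unique (vars I) → Unique (vars J) → ⟦ I ⟧ b ≐ ⟦ J ⟧ b′ → I ≡ J × b ≡ b′
    ⟦⟧-injective I J uI uJ I≐J
      with firstLayer-transfer I J uJ I≐J (proj₂ (proj₂ (inside-layer (firstLayer I))))
    ... | _ , refl = ⟦⟧-injective-layer I J uI uJ I≐J sameLayer , refl
      where
      sameLayer : firstLayer I ≡ firstLayer J
      sameLayer = layer-ext (firstLayer-valid I uI) (firstLayer-valid J uJ)
        (λ has → proj₁ (firstLayer-transfer I J uJ I≐J has))
        (λ has → proj₁ (firstLayer-transfer J I uI (sym ∘ I≐J) has))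

    ⟦⟧-injective-layer : ∀ I J {b} → Unique (vars I) → Unique (vars J) → ⟦ I ⟧ b ≐ ⟦ J ⟧ b →
      firstLayer I ≡ firstLayer J → I ≡ J
    ⟦⟧-injective-layer (end v w) (end v′ w′) _ _ _ refl = refl
    ⟦⟧-injective-layer (single v a I) (single v′ a′ J) {b} (v∉I ∷ uI) (v∉J ∷ uJ) I≐J refl =
      cong (single v a) (proj₁ (⟦⟧-injective I J uI uJ λ x →
        trans (sym (single-peel v a I b x (All¬⇒¬Any v∉I)))
              (trans (I≐J (set x v (not a))) (single-peel v a J b x (All¬⇒¬Any v∉J)))))
    ⟦⟧-injective-layer (pair v w I) (pair v′ w′ J) {b}
                       ((v≢w ∷ v∉I) ∷ w∉I ∷ uI) ((_ ∷ v∉J) ∷ w∉J ∷ uJ) I≐J refl =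
      cong (pair v w) (proj₁ (⟦⟧-injective I J uI uJ λ x →
        trans (sym (pair-peel v w I b x v≢w (All¬⇒¬Any v∉I) (All¬⇒¬Any w∉I)))
              (trans (I≐J (missPair x v w)) (pair-peel v w J b x v≢w (All¬⇒¬Any v∉J) (All¬⇒¬Any w∉J)))))
    ⟦⟧-injective-layer (pair v w I) (end v′ w′) uI _ I≐J refl = ⊥-elim (pair≢end v w I _ uI I≐J)
    ⟦⟧-injective-layer (end v w) (pair v′ w′ J) _ uJ I≐J refl = ⊥-elim (pair≢end v w J _ uJ (sym ∘ I≐J))
    ⟦⟧-injective-layer (end _ _)      (single _ _ _) _ _ _ ()
    ⟦⟧-injective-layer (single _ _ _) (end _ _)      _ _ _ ()
    ⟦⟧-injective-layer (single _ _ _) (pair _ _ _)   _ _ _ ()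
    ⟦⟧-injective-layer (pair _ _ _)   (single _ _ _) _ _ _ ()

  end-injective : ∀ {v w v′ w′} → end v w ≡ end v′ w′ → v ≡ v′ × w ≡ w′
  end-injective refl = refl , refl

  single-injective : ∀ {v a I v′ a′ J} → single v a I ≡ single v′ a′ J → v ≡ v′ × I ≡ J
  single-injective refl = refl , refl

  pair-injective : ∀ {v w I v′ w′ J} → pair v w I ≡ pair v′ w′ J → v ≡ v′ × w ≡ w′ × I ≡ J
  pair-injective refl = refl , refl , refl

  rename : (Var → Var) → Chain → Chain
  rename σ (end v w)      = end (σ v) (σ w)
  rename σ (single v a I) = single (σ v) a (rename σ I)
  rename σ (pair v w I)   = pair (σ v) (σ w) (rename σ I)

  ⟦⟧-rename : ∀ σ I b x → ⟦ I ⟧ b (x ∘ σ) ≡ ⟦ rename σ I ⟧ b x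
  ⟦⟧-rename σ (end v w)      b x = refl
  ⟦⟧-rename σ (single v a I) b x = cong (canalize (x (σ v)) a b) (⟦⟧-rename σ I (not b) x)
  ⟦⟧-rename σ (pair v w I)   b x =
    cong (λ r → canalize (x (σ v)) false b (canalize (x (σ w)) true b r)) (⟦⟧-rename σ I (not b) x)

  vars-rename : ∀ σ I → vars (rename σ I) ≡ map σ (vars I)
  vars-rename σ (end v w)      = refl
  vars-rename σ (single v a I) = cong (σ v ∷_) (vars-rename σ I)
  vars-rename σ (pair v w I)   = cong (λ vs → σ v ∷ σ w ∷ vs) (vars-rename σ I)

  rename-fixes : ∀ σ I → rename σ I ≡ I → ∀ {i} → i ∈ vars I → σ i ≡ i
  rename-fixes σ (end v w)      e (here refl)         = proj₁ (end-injective e)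
  rename-fixes σ (end v w)      e (there (here refl)) = proj₂ (end-injective e)
  rename-fixes σ (single v a I) e (here refl)         = proj₁ (single-injective e)
  rename-fixes σ (single v a I) e (there i∈I)         = rename-fixes σ I (proj₂ (single-injective e)) i∈I
  rename-fixes σ (pair v w I)   e (here refl)         = proj₁ (pair-injective e)
  rename-fixes σ (pair v w I)   e (there (here refl)) = proj₁ (proj₂ (pair-injective e))
  rename-fixes σ (pair v w I)   e (there (there i∈I)) = rename-fixes σ I (proj₂ (proj₂ (pair-injective e))) i∈I

  ⟦⟧-stronglyAsymmetric : ∀ I b → Unique (vars I) → (∀ i → i ∈ vars I) → StronglyAsymmetric (⟦ I ⟧ b)
  ⟦⟧-stronglyAsymmetric I b uI cover σ invariant i =
    rename-fixes (σ ⟨$⟩ʳ_) I (proj₁ (⟦⟧-injective (rename (σ ⟨$⟩ʳ_) I) I uσI uI σI≐I)) (cover i)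
    where
    uσI : Unique (vars (rename (σ ⟨$⟩ʳ_) I))
    uσI = subst Unique (sym (vars-rename _ I)) (Unique.map⁺ (Injection.injective (↔⇒↣ σ)) uI)
    σI≐I : ⟦ rename (σ ⟨$⟩ʳ_) I ⟧ b ≐ ⟦ I ⟧ b
    σI≐I x = trans (sym (⟦⟧-rename _ I b x)) (invariant x)

  length-rules≢0 : ∀ I b → length (rules I b) ≢ 0
  length-rules≢0 (end _ _)      b ()
  length-rules≢0 (single _ _ _) b ()
  length-rules≢0 (pair _ _ _)   b ()

  output-lastRule : ∀ I b (l : Fin (length (rules I b))) → suc (toℕ l) ≡ length (rules I b) →
    output (lookup (rules I b) l) ≡ lastOutput I b
  output-lastRule (end v w)      b (suc zero)    _      = refl
  output-lastRule (single v a I) b zero          isLast =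
    contradiction (sym (suc-injective isLast)) (length-rules≢0 I (not b))
  output-lastRule (single v a I) b (suc l)       isLast = output-lastRule I (not b) l (suc-injective isLast)
  output-lastRule (pair v w I)   b (suc zero)    isLast =
    contradiction (sym (suc-injective (suc-injective isLast))) (length-rules≢0 I (not b))
  output-lastRule (pair v w I)   b (suc (suc l)) isLast =
    output-lastRule I (not b) l (suc-injective (suc-injective isLast))

  ⟦⟧-IsNCF : ∀ I b → Unique (vars I) → (∀ i → i ∈ vars I) → IsNCF (⟦ I ⟧ b)
  ⟦⟧-IsNCF I b uI cover =
    decide-IsNCF (rules I b) _ (subst Unique (sym (varsOf-rules I b)) uI)
      (λ i → subst (i ∈_) (sym (varsOf-rules I b)) (cover i))
      (λ l isLast → trans (output-lastRule I b l isLast) (sym (not-involutive _)))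

  -- Normalizing a rigid decision list

  record ChainFor (R : List Rule) (d b : Bool) : Set where
    field
      chain       : Chain
      ≐-chain     : decide R d ≐ ⟦ chain ⟧ b
      vars-unique : Unique (vars chain)
      vars⊆       : vars chain ⊆ varsOf R
      ⊆vars       : varsOf R ⊆ vars chain
  open ChainFor public

  chainFor-transport : ∀ {R R′ d d′ b} → decide R d ≐ decide R′ d′ →
    varsOf R ⊆ varsOf R′ → varsOf R′ ⊆ varsOf R → ChainFor R′ d′ b → ChainFor R d b
  chainFor-transport R≐R′ R⊆R′ R′⊆R cf = record
    { chain       = chain cf
    ; ≐-chain     = λ x → trans (R≐R′ x) (≐-chain cf x)
    ; vars-unique = vars-unique cf
    ; vars⊆       = R′⊆R ∘ vars⊆ cf
    ; ⊆vars       = ⊆vars cf ∘ R⊆R′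
    }

  chainFor-single : ∀ u a b R d → u ∉ varsOf R → ChainFor R d (not b) → ChainFor (rule u a b ∷ R) d b
  chainFor-single u a b R d u∉R cf = record
    { chain       = single u a (chain cf)
    ; ≐-chain     = λ x → cong (canalize (x u) a b) (≐-chain cf x)
    ; vars-unique = ¬Any⇒All¬ _ (u∉R ∘ vars⊆ cf) ∷ vars-unique cf
    ; vars⊆       = ∷⁺ʳ u (vars⊆ cf)
    ; ⊆vars       = ∷⁺ʳ u (⊆vars cf)
    }

  chainFor-pair : ∀ u w b R d → u ≢ w → u ∉ varsOf R → w ∉ varsOf R →
    ChainFor R d (not b) → ChainFor (rule u false b ∷ rule w true b ∷ R) d b
  chainFor-pair u w b R d u≢w u∉R w∉R cf = record
    { chain       = pair u w (chain cf)
    ; ≐-chain     = λ x → cong (λ r → canalize (x u) false b (canalize (x w) true b r)) (≐-chain cf x)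
    ; vars-unique = (u≢w ∷ ¬Any⇒All¬ _ (u∉R ∘ vars⊆ cf)) ∷ ¬Any⇒All¬ _ (w∉R ∘ vars⊆ cf) ∷ vars-unique cf
    ; vars⊆       = ∷⁺ʳ u (∷⁺ʳ w (vars⊆ cf))
    ; ⊆vars       = ∷⁺ʳ u (∷⁺ʳ w (⊆vars cf))
    }

  swap⊆ : ∀ {u w : Var} {vs} → u ∷ w ∷ vs ⊆ w ∷ u ∷ vs
  swap⊆ = ⊆-reflexive-↭ (↭-swap _ _ ↭-refl)

  chainFor-end : ∀ u w a a′ b → u ≢ w →
    Rigid (u ∷ w ∷ []) (decide (rule u a b ∷ rule w a′ b ∷ []) (not b)) →
    ChainFor (rule u a b ∷ rule w a′ b ∷ []) (not b) b
  chainFor-end u w false false b u≢w rig =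
    ⊥-elim (rig u≢w (here refl) (there (here refl)) (decide-swap-twins false b [] (not b) (λ ()) (λ ())))
  chainFor-end u w true  true  b u≢w rig =
    ⊥-elim (rig u≢w (here refl) (there (here refl)) (decide-swap-twins true b [] (not b) (λ ()) (λ ())))
  chainFor-end u w false true  b u≢w rig = record
    { chain = end u w ; ≐-chain = λ x → refl ; vars-unique = (u≢w ∷ []) ∷ [] ∷ [] ; vars⊆ = id ; ⊆vars = id }
  chainFor-end u w true  false b u≢w rig = record
    { chain       = end w u
    ; ≐-chain     = λ x → canalize-comm (x u) true (x w) false b (not b)
    ; vars-unique = ((u≢w ∘ sym) ∷ []) ∷ [] ∷ []
    ; vars⊆       = swap⊆
    ; ⊆vars       = swap⊆
    }

  mutual
    normalize : ∀ r s R d → Unique (varsOf (r ∷ s ∷ R)) → d ≡ not (output (lastRule s R)) →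
      Rigid (varsOf (r ∷ s ∷ R)) (decide (r ∷ s ∷ R) d) → ChainFor (r ∷ s ∷ R) d (output r)
    normalize (rule u a b) (rule w a′ b′) [] d ((u≢w ∷ _) ∷ _) refl rig =
      chainFor-transport retargeted id id (chainFor-end u w a a″ b u≢w (rigid-≐ retargeted rig))
      where
      a″ = proj₁ (canalize-retarget b b′ a′)
      retargeted : decide (rule u a b ∷ rule w a′ b′ ∷ []) (not b′) ≐ decide (rule u a b ∷ rule w a″ b ∷ []) (not b)
      retargeted x = cong (canalize (x u) a b) (proj₂ (canalize-retarget b b′ a′) (x w))
    normalize (rule u a b) (rule w a′ b′) (t ∷ R) d uniq last rig with b′ ≟ᵇ b
    ... | yes refl = normalizeLayer u w a a′ b t R d uniq last rig
    ... | no b′≢b with ¬-not b′≢b | uniq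
    ...   | refl | u∉ ∷ uniq′ =
      chainFor-single u a b _ d (All¬⇒¬Any u∉)
        (normalize (rule w a′ (not b)) t R d uniq′ last (rigid-tail (rule u a b) _ d (All¬⇒¬Any u∉) rig))

    normalizeLayer : ∀ u w a a′ b t R d → Unique (varsOf (rule u a b ∷ rule w a′ b ∷ t ∷ R)) →
      d ≡ not (output (lastRule t R)) → Rigid (varsOf (rule u a b ∷ rule w a′ b ∷ t ∷ R)) (decide (rule u a b ∷ rule w a′ b ∷ t ∷ R) d) →
      ChainFor (rule u a b ∷ rule w a′ b ∷ t ∷ R) d b
    normalizeLayer u w false false b t R d ((u≢w ∷ u∉R) ∷ w∉R ∷ _) _ rig =
      ⊥-elim (rig u≢w (here refl) (there (here refl))
        (decide-swap-twins false b (t ∷ R) d (All¬⇒¬Any u∉R) (All¬⇒¬Any w∉R)))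
    normalizeLayer u w true  true  b t R d ((u≢w ∷ u∉R) ∷ w∉R ∷ _) _ rig =
      ⊥-elim (rig u≢w (here refl) (there (here refl))
        (decide-swap-twins true b (t ∷ R) d (All¬⇒¬Any u∉R) (All¬⇒¬Any w∉R)))
    normalizeLayer u w false true  b t R d uniq last rig = normalizePair u w b t R d uniq last rig
    normalizeLayer u w true  false b t R d ((u≢w ∷ u∉R) ∷ w∉R ∷ uniq) last rig =
      chainFor-transport commuted swap⊆ swap⊆
        (normalizePair w u b t R d (((u≢w ∘ sym) ∷ w∉R) ∷ u∉R ∷ uniq) last (rigid-≐ commuted (rigid-⊆ swap⊆ rig)))
      where
      commuted : decide (rule u true b ∷ rule w false b ∷ t ∷ R) d ≐ decide (rule w false b ∷ rule u true b ∷ t ∷ R) d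
      commuted x = canalize-comm (x u) true (x w) false b _

    normalizePair : ∀ u w b t R d → Unique (varsOf (rule u false b ∷ rule w true b ∷ t ∷ R)) →
      d ≡ not (output (lastRule t R)) →
      Rigid (varsOf (rule u false b ∷ rule w true b ∷ t ∷ R)) (decide (rule u false b ∷ rule w true b ∷ t ∷ R) d) →
      ChainFor (rule u false b ∷ rule w true b ∷ t ∷ R) d b
    normalizePair u w b (rule v a b′) [] d uniq refl rig =
      ⊥-elim (layer-of-three u w v false a″ b [] (not b) uniq (rigid-≐ retargeted rig))
      where
      a″ = proj₁ (canalize-retarget b b′ a)
      retargeted : decide (rule u false b ∷ rule w true b ∷ rule v a b′ ∷ []) (not b′)
                   ≐ decide (rule u false b ∷ rule w true b ∷ rule v a″ b ∷ []) (not b)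
      retargeted x = cong (λ r → canalize (x u) false b (canalize (x w) true b r))
                          (proj₂ (canalize-retarget b b′ a) (x v))
    normalizePair u w b (rule v a b′) (t ∷ R) d uniq last rig with b′ ≟ᵇ b
    ... | yes refl = ⊥-elim (layer-of-three u w v false a b (t ∷ R) d uniq rig)
    ... | no b′≢b with ¬-not b′≢b | uniq
    ...   | refl | (u≢w ∷ u∉R) ∷ w∉R ∷ uniq′ =
      chainFor-pair u w b _ d u≢w (All¬⇒¬Any u∉R) (All¬⇒¬Any w∉R)
        (normalize (rule v a (not b)) t R d uniq′ last
          (rigid-tail (rule w true b) _ d (All¬⇒¬Any w∉R)
            (rigid-tail (rule u false b) _ d (All¬⇒¬Any (u≢w ∷ u∉R)) rig)))

  stronglyAsymmetric⇒rigid : ∀ {f} vs → StronglyAsymmetric f → Rigid vs f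
  stronglyAsymmetric⇒rigid vs sa {u} {w} u≢w _ _ invariant =
    u≢w (trans (sym (sa (transpose u w) invariant u)) (transpose-left u w))

  -- Enumerating chains

  without : Var → List Var → List Var
  without u = filter (λ w → ¬? (w ≟ᶠ u))

  ∈-without⁻ : ∀ {i u} V → i ∈ without u V → i ∈ V × i ≢ u
  ∈-without⁻ V = ∈-filter⁻ _ {xs = V}

  ∈-without⁺ : ∀ {i u V} → i ∈ V → i ≢ u → i ∈ without u V
  ∈-without⁺ = ∈-filter⁺ _

  without-unique : ∀ u {V} → Unique V → Unique (without u V)
  without-unique u = Unique.filter⁺ _

  length-without : ∀ {u} V → Unique V → u ∈ V → suc (length (without u V)) ≡ length V
  length-without {u} (w ∷ V) (w∉V ∷ uV) u∈ with w ≟ᶠ u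
  ... | yes refl = cong (suc ∘ length) (filter-all _ (All.map (_∘ sym) w∉V))
  ... | no w≢u with u∈
  ...   | here u≡w  = contradiction (sym u≡w) w≢u
  ...   | there u∈V = cong suc (length-without V uV u∈V)

  length-without-≤ : ∀ {u V f} → Unique V → u ∈ V → length V ≤ suc f → length (without u V) ≤ f
  length-without-≤ {V = V} uV u∈V le = ≤-pred (subst (_≤ _) (sym (length-without V uV u∈V)) le)

  Arrangement : List Var → List Var → Set
  Arrangement xs V = Unique xs × xs ⊆ V × V ⊆ xs

  arrangement-∷ : ∀ {u xs V} → u ∈ V → Arrangement xs (without u V) → Arrangement (u ∷ xs) V
  arrangement-∷ {u} {xs} {V} u∈V (uxs , xs⊆ , ⊆xs) = (¬Any⇒All¬ _ u∉xs ∷ uxs) , ∷⊆ , ⊆∷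
    where
    u∉xs : u ∉ xs
    u∉xs u∈xs = proj₂ (∈-without⁻ V (xs⊆ u∈xs)) refl
    ∷⊆ : u ∷ xs ⊆ V
    ∷⊆ (here refl)  = u∈V
    ∷⊆ (there i∈xs) = proj₁ (∈-without⁻ V (xs⊆ i∈xs))
    ⊆∷ : V ⊆ u ∷ xs
    ⊆∷ {i} i∈V with i ≟ᶠ u
    ... | yes i≡u = here i≡u
    ... | no i≢u  = there (⊆xs (∈-without⁺ i∈V i≢u))

  arrangement-∷⁻ : ∀ {u xs V} → Arrangement (u ∷ xs) V → u ∈ V × Arrangement xs (without u V)
  arrangement-∷⁻ {u} {xs} {V} ((u∉xs ∷ uxs) , ∷⊆ , ⊆∷) = ∷⊆ (here refl) , uxs , xs⊆ , ⊆xs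
    where
    xs⊆ : xs ⊆ without u V
    xs⊆ i∈xs = ∈-without⁺ (∷⊆ (there i∈xs)) λ { refl → All¬⇒¬Any u∉xs i∈xs }
    ⊆xs : without u V ⊆ xs
    ⊆xs i∈ with ∈-without⁻ V i∈
    ... | i∈V , i≢u with ⊆∷ i∈V
    ...   | here i≡u   = contradiction i≡u i≢u
    ...   | there i∈xs = i∈xs

  Exact : Chain → List Var → Set
  Exact I V = Arrangement (vars I) V

  layerFst : Layer → Var
  layerFst (one u a) = u
  layerFst (two u w) = u

  layersFrom : List Var → Var → List Layer
  layersFrom V u = one u false ∷ one u true ∷ map (two u) (without u V)

  ends : Var → Var → List Var → List Chain
  ends u w []      = end u w ∷ []
  ends u w (_ ∷ _) = []

  -- f is fuel: chains f V is complete once length V ≤ f.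
  mutual
    chains : ℕ → List Var → List Chain
    chains zero    V = []
    chains (suc f) V = concatMap (headedBy f V) V

    headedBy : ℕ → List Var → Var → List Chain
    headedBy f V u = concatMap (λ ℓ → startingWith f ℓ V) (layersFrom V u)

    startingWith : ℕ → Layer → List Var → List Chain
    startingWith f (one u a) V = map (single u a) (chains f (without u V))
    startingWith f (two u w) V = ends u w V′ ++ map (pair u w) (chains f V′)
      where
      V′ = without w (without u V)

  ∈-ends⁻ : ∀ u w {V I} → I ∈ ends u w V → V ≡ [] × I ≡ end u w
  ∈-ends⁻ u w {[]} (here refl) = refl , refl

  firstLayer-startingWith : ∀ f ℓ V {I} → I ∈ startingWith f ℓ V → firstLayer I ≡ ℓ
  firstLayer-startingWith f (one u a) V I∈ with ∈-map⁻ (single u a) {xs = chains f (without u V)} I∈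
  ... | _ , _ , refl = refl
  firstLayer-startingWith f (two u w) V I∈ with ∈-++⁻ (ends u w (without w (without u V))) I∈
  ... | inj₁ I∈ends with ∈-ends⁻ u w I∈ends
  ...   | _ , refl = refl
  firstLayer-startingWith f (two u w) V I∈ | inj₂ I∈pairs
    with ∈-map⁻ (pair u w) {xs = chains f (without w (without u V))} I∈pairs
  ...   | _ , _ , refl = refl

  layersFrom-unique : ∀ u V → Unique V → Unique (layersFrom V u)
  layersFrom-unique u V uV =
    ((λ ()) ∷ ¬Any⇒All¬ _ one∉) ∷ ¬Any⇒All¬ _ one∉ ∷ Unique.map⁺ (proj₂ ∘ two-injective) (without-unique u uV)
    where
    two-injective : ∀ {w w′} → two u w ≡ two u w′ → u ≡ u × w ≡ w′
    two-injective refl = refl , refl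
    one∉ : ∀ {a} → one u a ∉ map (two u) (without u V)
    one∉ m with ∈-map⁻ (two u) m
    ... | _ , _ , ()

  ∈-layersFrom⁻ : ∀ V u {ℓ} → ℓ ∈ layersFrom V u →
    (∃[ a ] ℓ ≡ one u a) ⊎ (∃[ w ] (w ∈ without u V × ℓ ≡ two u w))
  ∈-layersFrom⁻ V u (here refl)         = inj₁ (false , refl)
  ∈-layersFrom⁻ V u (there (here refl)) = inj₁ (true , refl)
  ∈-layersFrom⁻ V u (there (there m))   = inj₂ (∈-map⁻ (two u) {xs = without u V} m)

  layerFst-layersFrom : ∀ V u {ℓ} → ℓ ∈ layersFrom V u → layerFst ℓ ≡ u
  layerFst-layersFrom V u ℓ∈ with ∈-layersFrom⁻ V u ℓ∈
  ... | inj₁ (_ , refl)     = refl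
  ... | inj₂ (_ , _ , refl) = refl

  mutual
    chains-unique : ∀ f V → Unique V → Unique (chains f V)
    chains-unique zero    V uV = []
    chains-unique (suc f) V uV =
      concatMap-unique _ (layerFst ∘ firstLayer) firstLayerFst uV λ {u} _ →
        concatMap-unique _ firstLayer (firstLayer-startingWith f _ V) (layersFrom-unique u V uV) λ {ℓ} _ →
          startingWith-unique f ℓ V uV
      where
      firstLayerFst : ∀ {u I} → I ∈ headedBy f V u →
        layerFst (firstLayer I) ≡ u
      firstLayerFst {u} I∈ with ∈-concatMap⁻′ (λ ℓ → startingWith f ℓ V) {xs = layersFrom V u} I∈
      ... | ℓ , ℓ∈ , I∈ℓ = trans (cong layerFst (firstLayer-startingWith f ℓ V I∈ℓ)) (layerFst-layersFrom V u ℓ∈)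

    startingWith-unique : ∀ f ℓ V → Unique V → Unique (startingWith f ℓ V)
    startingWith-unique f (one u a) V uV =
      Unique.map⁺ (proj₂ ∘ single-injective) (chains-unique f (without u V) (without-unique u uV))
    startingWith-unique f (two u w) V uV =
      Unique.++⁺ (ends-unique V′) (Unique.map⁺ (proj₂ ∘ proj₂ ∘ pair-injective) (chains-unique f V′ uV′))
        λ (I∈ends , I∈pairs) → end≢pair (proj₂ (∈-ends⁻ u w I∈ends)) (∈-map⁻ (pair u w) {xs = chains f V′} I∈pairs)
      where
      V′ = without w (without u V)
      uV′ : Unique V′
      uV′ = without-unique w (without-unique u uV)
      ends-unique : ∀ V′ → Unique (ends u w V′)
      ends-unique []      = [] ∷ []
      ends-unique (_ ∷ _) = []
      end≢pair : ∀ {I xs} → I ≡ end u w → ∃[ J ] (J ∈ xs × I ≡ pair u w J) → ⊥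
      end≢pair refl (_ , _ , ())

  startingWith-sound : ∀ f V → Unique V → (∀ V′ → Unique V′ → ∀ {I} → I ∈ chains f V′ → Exact I V′) →
    ∀ {u ℓ I} → u ∈ V → ℓ ∈ layersFrom V u → I ∈ startingWith f ℓ V → Exact I V
  startingWith-sound f V uV sound {u} u∈V ℓ∈ I∈ with ∈-layersFrom⁻ V u ℓ∈
  ... | inj₁ (a , refl) with ∈-map⁻ (single u a) {xs = chains f (without u V)} I∈
  ...   | J , J∈ , refl = arrangement-∷ u∈V (sound (without u V) (without-unique u uV) J∈)
  startingWith-sound f V uV sound {u} u∈V ℓ∈ I∈ | inj₂ (w , w∈ , refl)
    with ∈-++⁻ (ends u w (without w (without u V))) I∈
  ...   | inj₁ I∈ends with ∈-ends⁻ u w I∈ends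
  ...     | V′≡[] , refl = arrangement-∷ u∈V (arrangement-∷ w∈ ([] , (λ ()) , λ i∈ → subst (_ ∈_) V′≡[] i∈))
  startingWith-sound f V uV sound {u} u∈V ℓ∈ I∈ | inj₂ (w , w∈ , refl) | inj₂ I∈pairs
    with ∈-map⁻ (pair u w) {xs = chains f (without w (without u V))} I∈pairs
  ...   | J , J∈ , refl =
    arrangement-∷ u∈V (arrangement-∷ w∈ (sound (without w (without u V)) (without-unique w (without-unique u uV)) J∈))

  chains-sound : ∀ f V → Unique V → ∀ {I} → I ∈ chains f V → Exact I V
  chains-sound (suc f) V uV I∈ with ∈-concatMap⁻′ (headedBy f V) {xs = V} I∈
  ... | u , u∈V , I∈u with ∈-concatMap⁻′ (λ ℓ → startingWith f ℓ V) {xs = layersFrom V u} I∈u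
  ...   | ℓ , ℓ∈ , I∈ℓ = startingWith-sound f V uV (chains-sound f) u∈V ℓ∈ I∈ℓ

  layerFst∈vars : ∀ I → layerFst (firstLayer I) ∈ vars I
  layerFst∈vars (end v w)      = here refl
  layerFst∈vars (single v a I) = here refl
  layerFst∈vars (pair v w I)   = here refl

  mutual
    chains-complete : ∀ f V → Unique V → length V ≤ f → ∀ I → Exact I V → I ∈ chains f V
    chains-complete zero [] _ _ I (_ , vars⊆ , _) with vars⊆ (layerFst∈vars I)
    ... | ()
    chains-complete (suc f) V uV le I exact =
      let (ℓ∈ , I∈ℓ) = startingWith-complete f V uV le I exact
      in ∈-concatMap⁺ (headedBy f V) (lose (proj₁ (proj₂ exact) (layerFst∈vars I))
           (∈-concatMap⁺ (λ ℓ → startingWith f ℓ V) (lose ℓ∈ I∈ℓ)))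

    startingWith-complete : ∀ f V → Unique V → length V ≤ suc f → ∀ I → Exact I V →
      firstLayer I ∈ layersFrom V (layerFst (firstLayer I)) × I ∈ startingWith f (firstLayer I) V
    startingWith-complete f V uV le (single u a J) exact =
      let (u∈V , exactJ) = arrangement-∷⁻ exact
      in layer∈ a , ∈-map⁺ (single u a)
           (chains-complete f (without u V) (without-unique u uV) (length-without-≤ uV u∈V le) J exactJ)
      where
      layer∈ : ∀ a → one u a ∈ layersFrom V u
      layer∈ false = here refl
      layer∈ true  = there (here refl)
    startingWith-complete f V uV le (pair u w J) exact =
      let (u∈V , exact′) = arrangement-∷⁻ exact
          (w∈ , exactJ) = arrangement-∷⁻ exact′
          le′ = ≤-trans (length-without-≤ uV u∈V le) (n≤1+n f)
      in there (there (∈-map⁺ (two u) w∈)) ,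
         ∈-++⁺ʳ (ends u w _) (∈-map⁺ (pair u w)
           (chains-complete f _ (without-unique w (without-unique u uV))
              (length-without-≤ (without-unique u uV) w∈ le′) J exactJ))
    startingWith-complete f V uV le (end u w) exact =
      let (u∈V , exact′) = arrangement-∷⁻ exact
          (w∈ , _ , _ , ⊆[]) = arrangement-∷⁻ exact′
      in there (there (∈-map⁺ (two u) w∈)) , ∈-++⁺ˡ (end∈ends (⊆[]⇒≡[] ⊆[]))
      where
      end∈ends : ∀ {V′} → V′ ≡ [] → end u w ∈ ends u w V′
      end∈ends refl = here refl

  ends-length : ∀ u w V → length (ends u w V) + chainCount (length V) ≡ tailCount (length V)
  ends-length u w []      = refl
  ends-length u w (_ ∷ _) = refl

  mutual
    chains-length : ∀ f V → Unique V → length V ≤ f → length (chains f V) ≡ chainCount (length V)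
    chains-length zero    []       _  _  = refl
    chains-length (suc f) []       _  _  = refl
    chains-length (suc f) (v ∷ V₀) uV le =
      trans (length-concatMap-const (headedBy f (v ∷ V₀)) (v ∷ V₀) (headedBy-length f v V₀ uV le))
            (sym (chainCount-suc (length V₀)))

    headedBy-length : ∀ f v V₀ → Unique (v ∷ V₀) → length (v ∷ V₀) ≤ suc f → ∀ {u} → u ∈ v ∷ V₀ →
      let k = length V₀ in
      length (headedBy f (v ∷ V₀) u) ≡ chainCount k + (chainCount k + k * tailCount (pred k))
    headedBy-length f v V₀ uV le {u} u∈V =
      trans (length-++ (startingWith f (one u false) V))
        (cong₂ _+_ (single-length false)
          (trans (length-++ (startingWith f (one u true) V))
            (cong₂ _+_ (single-length true)
              (trans (length-concatMap-const (λ ℓ → startingWith f ℓ V) (map (two u) V′) pair-length)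
                     (cong (_* tailCount (pred k)) (trans (length-map (two u) V′) length-V′))))))
      where
      V = v ∷ V₀
      k = length V₀
      V′ = without u V
      uV′ = without-unique u uV
      length-V′ : length V′ ≡ k
      length-V′ = suc-injective (length-without V uV u∈V)
      single-length : ∀ a → length (startingWith f (one u a) V) ≡ chainCount k
      single-length a =
        trans (length-map (single u a) (chains f V′))
          (trans (chains-length f V′ uV′ (length-without-≤ uV u∈V le)) (cong chainCount length-V′))
      pair-length : ∀ {ℓ} → ℓ ∈ map (two u) V′ → length (startingWith f ℓ V) ≡ tailCount (pred k)
      pair-length ℓ∈ with ∈-map⁻ (two u) {xs = V′} ℓ∈
      ... | w , w∈ , refl =
        trans (length-++ (ends u w V″))
          (trans (cong (λ z → length (ends u w V″) + z)
                   (trans (length-map (pair u w) (chains f V″)) (chains-length f V″ uV″ fuel)))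
            (trans (ends-length u w V″) (cong tailCount length-V″)))
        where
        V″ = without w V′
        uV″ = without-unique w uV′
        length-V″ : length V″ ≡ pred k
        length-V″ = cong pred (trans (length-without V′ uV′ w∈) length-V′)
        fuel : length V″ ≤ f
        fuel = length-without-≤ uV′ w∈ (≤-trans (length-without-≤ uV u∈V le) (n≤1+n f))

module StronglyAsymmetricNCFs (m : ℕ) where

  n : ℕ
  n = suc (suc m)

  open NestedCanalizing n

  allFin-unique : Unique (allFin n)
  allFin-unique = Unique.allFin⁺ n

  length-allFin : length (allFin n) ≡ n
  length-allFin = length-tabulate id

  normalForms : List Chain
  normalForms = chains n (allFin n)

  normalForm-exact : ∀ {I} → I ∈ normalForms → Unique (vars I) × (∀ i → i ∈ vars I)
  normalForm-exact I∈ =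
    let (uI , _ , ⊆vars) = chains-sound n (allFin n) allFin-unique I∈ in uI , λ i → ⊆vars (∈-allFin i)

  functionsOf : Bool → List (BoolFun n)
  functionsOf b = map (λ I → ⟦ I ⟧ b) normalForms

  saNCFs : List (BoolFun n)
  saNCFs = functionsOf false ++ functionsOf true

  saNCFs-valid : All (λ f → IsNCF f × StronglyAsymmetric f) saNCFs
  saNCFs-valid = All.++⁺ (valid false) (valid true)
    where
    valid : ∀ b → All (λ f → IsNCF f × StronglyAsymmetric f) (functionsOf b)
    valid b = All.map⁺ (All.tabulate λ I∈ →
      let (uI , cover) = normalForm-exact I∈ in ⟦⟧-IsNCF _ b uI cover , ⟦⟧-stronglyAsymmetric _ b uI cover)

  saNCFs-distinct : AllPairs (λ f g → ¬ (f ≐ g)) saNCFs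
  saNCFs-distinct = AllPairs.++⁺ (distinct false) (distinct true) across
    where
    injective : ∀ {I J b b′} → I ∈ normalForms → J ∈ normalForms → ⟦ I ⟧ b ≐ ⟦ J ⟧ b′ → I ≡ J × b ≡ b′
    injective I∈ J∈ = ⟦⟧-injective _ _ (proj₁ (normalForm-exact I∈)) (proj₁ (normalForm-exact J∈))
    distinct : ∀ b → AllPairs (λ f g → ¬ (f ≐ g)) (functionsOf b)
    distinct b = AllPairs.map⁺ (Unique⇒AllPairs (λ I∈ J∈ I≢J I≐J → I≢J (proj₁ (injective I∈ J∈ I≐J)))
                                                 (chains-unique n (allFin n) allFin-unique))
    across : All (λ f → All (λ g → ¬ (f ≐ g)) (functionsOf true)) (functionsOf false)
    across = All.map⁺ (All.tabulate λ I∈ → All.map⁺ (All.tabulate λ J∈ I≐J → false≢true (proj₂ (injective I∈ J∈ I≐J))))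
      where
      false≢true : false ≢ true
      false≢true ()

  saNCF-normalForm : ∀ f → IsNCF f → StronglyAsymmetric f →
    Σ[ I ∈ Chain ] Σ[ b ∈ Bool ] (I ∈ normalForms × f ≐ ⟦ I ⟧ b)
  saNCF-normalForm f (σ , a , b , hit , allMiss) sa =
    chain cf , b zero ,
    chains-complete n (allFin n) allFin-unique (≤-reflexive length-allFin) (chain cf) exact ,
    λ x → trans (f≐R x) (≐-chain cf x)
    where
    r : Fin n → Rule
    r k = rule (σ ⟨$⟩ʳ k) (a k) (b k)
    R = tabulate r
    d = not (b (fromℕ (suc m)))
    f≐R : f ≐ decide R d
    f≐R x = IsNCF⇒decide r d f x (hit x) (allMiss x (fromℕ (suc m)) (cong suc (toℕ-fromℕ (suc m))))
    varsOf-R : varsOf R ≡ tabulate (σ ⟨$⟩ʳ_)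
    varsOf-R = map-tabulate r var
    cover : ∀ i → i ∈ varsOf R
    cover i = subst (i ∈_) (sym varsOf-R) (subst (_∈ tabulate (σ ⟨$⟩ʳ_)) (inverseʳ σ) (∈-tabulate⁺ {f = σ ⟨$⟩ʳ_} (σ ⟨$⟩ˡ i)))
    cf : ChainFor R d (b zero)
    cf = normalize (r zero) (r (suc zero)) (tabulate (λ k → r (suc (suc k)))) d
           (subst Unique (sym varsOf-R) (Unique.tabulate⁺ (Injection.injective (↔⇒↣ σ))))
           (cong (not ∘ output) (sym (lastRule-tabulate m (λ k → r (suc k)))))
           (rigid-≐ f≐R (stronglyAsymmetric⇒rigid (varsOf R) sa))
    exact : Exact (chain cf) (allFin n)
    exact = vars-unique cf , (λ _ → ∈-allFin _) , λ {i} _ → ⊆vars cf (cover i)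

  saNCFs-complete : ∀ f → IsNCF f × StronglyAsymmetric f → ∃[ g ] (g ∈ saNCFs × f ≐ g)
  saNCFs-complete f (ncf , sa) with saNCF-normalForm f ncf sa
  ... | I , false , I∈ , f≐I = ⟦ I ⟧ false , ∈-++⁺ˡ (∈-map⁺ _ I∈) , f≐I
  ... | I , true  , I∈ , f≐I = ⟦ I ⟧ true , ∈-++⁺ʳ (functionsOf false) (∈-map⁺ _ I∈) , f≐I

  length-saNCFs : length saNCFs ≡ chainCount n + chainCount n
  length-saNCFs = trans (length-++ (functionsOf false)) (cong₂ _+_ (length-functionsOf false) (length-functionsOf true))
    where
    length-functionsOf : ∀ b → length (functionsOf b) ≡ chainCount n
    length-functionsOf b =
      trans (length-map _ normalForms)
        (trans (chains-length n (allFin n) allFin-unique (≤-reflexive length-allFin)) (cong chainCount length-allFin))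

theorem4p13 : (n : ℕ) → 2 ≤ n →
    Σ (List (BoolFun n)) λ L →
      Enumerates (λ f → IsNCF f × StronglyAsymmetric f) L
      × (√2 ⊛√ fromℕ√ (length L)
          ≡ fromℕ√ (n !) ⊛√ ((1+√2 ^√ (n ∸ 1)) ⊖√ (1-√2 ^√ (n ∸ 1))))
theorem4p13 (suc zero)    (s≤s ())
theorem4p13 (suc (suc m)) _ =
  saNCFs , (saNCFs-valid , saNCFs-distinct , saNCFs-complete) ,
  trans (cong (λ k → √2 ⊛√ fromℕ√ k) length-saNCFs) (√2-⊛-twicePell (n !) (suc m))
  where
  open StronglyAsymmetricNCFs m
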